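{- Let $h\ge 1$ and $t_1,s_1,\dots,t_h,s_h$ be positive integers with $\sum_{i=1}^h s_i=\sum_{i=1}^h t_i\ge 2$, and let $G$ be the threshold graph generated by $b=(0^{t_1}1^{s_1})(0^{t_2}1^{s_2})\cdots(0^{t_h}1^{s_h})$. Then $G$ is Hamiltonian if and only if $$\sum_{i=j}^h s_i\ \ge\ \sum_{i=j}^h t_i+1\qquad\text{for } j=2,3,\dots,h.$$
   Context: For a binary sequence $b=(b_1b_2\cdots b_n)$ the threshold graph $G(b)$ has vertex set $\{1,\dots,n\}$, and for $i<j$ the vertices $i,j$ are adjacent iff $b_j=1$. Notation $0^{t}$ / $1^{s}$ denotes a run of $t$ zeros / $s$ ones. A graph is Hamiltonian if it contains a cycle passing through all of its vertices. -}

module Defs where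

open import Data.Nat using (ℕ; _≤_)
open import Data.Bool using (Bool; true; false)
open import Data.Fin using (Fin) renaming (_<_ to _<ᶠ_)
open import Data.List using (List; []; _∷_; _++_; [_]; length; replicate; lookup; map; concatMap)
open import Data.Nat.ListAction using (sum)
open import Data.List.Membership.Propositional using (_∈_)
open import Data.List.Relation.Unary.Unique.Propositional using (Unique)
open import Data.List.Relation.Unary.Linked using (Linked)
open import Data.Product using (Σ; _×_; proj₁; proj₂; ∃)
open import Data.Sum using (_⊎_)
open import Relation.Binary.PropositionalEquality using (_≡_)

Hamiltonian : (n : ℕ) → (Fin n → Fin n → Set) → Set
Hamiltonian n Adj =
  Σ (Fin n) λ v → Σ (List (Fin n)) λ rest →
    Unique (v ∷ rest) × (∀ u → u ∈ (v ∷ rest)) × (3 ≤ length (v ∷ rest))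
    × Linked Adj (v ∷ rest ++ [ v ])

ThresholdAdj : (b : List Bool) → Fin (length b) → Fin (length b) → Set
ThresholdAdj b i j = (i <ᶠ j × lookup b j ≡ true) ⊎ (j <ᶠ i × lookup b i ≡ true)

blockSeq : List (ℕ × ℕ) → List Bool
blockSeq = concatMap (λ p → replicate (proj₁ p) false ++ replicate (proj₂ p) true)

sumT : List (ℕ × ℕ) → ℕ
sumT bs = sum (map proj₁ bs)

sumS : List (ℕ × ℕ) → ℕ
sumS bs = sum (map proj₂ bs)

module Submission where

open import Defs
open import Data.Nat using (ℕ; zero; suc; _+_; _*_; _≤_; _<_; _≤ᵇ_; z≤n; s≤s)
open import Data.Nat.Properties
open import Data.Nat.ListAction using (sum)
open import Data.Nat.ListAction.Properties using (sum-↭)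
open import Data.Nat.Tactic.RingSolver using (solve-∀)
open import Data.Bool using (Bool; true; false; not; _∧_; T)
import Data.Bool.Properties as Bool
open import Data.Fin using (Fin; toℕ; fromℕ<) renaming (zero to fzero; suc to fsuc; _<_ to _<ᶠ_)
open import Data.Fin.Properties using (toℕ-fromℕ<)
open import Data.Product using (_×_; _,_; proj₁; proj₂)
open import Data.Sum using (inj₁; inj₂)
open import Data.List using (List; []; _∷_; _++_; [_]; length; drop; take; replicate; map; lookup; tabulate; allFin)
open import Data.List.Properties using (++-assoc; ++-identityʳ; length-++; map-tabulate; length-tabulate; take++drop≡id; concatMap-++)
open import Data.List.Relation.Unary.All as All using (All; []; _∷_)
open import Data.List.Relation.Unary.All.Properties using () renaming (++⁺ to All-++⁺)
open import Data.List.Relation.Unary.Any using (Any; here; there)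
open import Data.List.Relation.Unary.Linked using (Linked; []; [-]; _∷_)
open import Data.List.Relation.Unary.Unique.Propositional using (Unique)
open import Data.List.Relation.Unary.Unique.Propositional.Properties using (allFin⁺)
open import Data.List.Membership.Propositional using (_∈_; lose)
open import Data.List.Membership.Propositional.Properties using (∈-allFin; ∈-++⁺ˡ)
open import Data.List.Membership.Propositional.Properties.WithK using (unique∧set⇒bag)
open import Data.List.Relation.Binary.BagAndSetEquality using (∼bag⇒↭)
open import Data.List.Relation.Binary.Permutation.Propositional using (_↭_; prep; ↭-refl; ↭-sym; ↭-trans; ↭⇒↭ₛ)
open import Data.List.Relation.Binary.Permutation.Propositional.Properties using (∈-resp-↭; ↭-length; shift; ++-comm; map⁺)
import Data.List.Relation.Binary.Permutation.Setoid.Properties as Permₛ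
open import Function using (_∘_; id)
open import Function.Bundles using (_⇔_; mk⇔; Equivalence)
open import Relation.Binary.Core using (_Preserves_⟶_)
open import Relation.Binary.PropositionalEquality using (_≡_; _≢_; refl; sym; trans; cong; cong₂; subst; subst₂; setoid; module ≡-Reasoning)
open import Relation.Nullary using (yes; no)
open import Data.Empty using (⊥-elim)

-- Fix a cut p ≥ 1 and, at the two ends of an edge x < y of G(b), count the ends at
-- positions ≥ p carrying a 0 and those carrying a 1. Since b_y = 1 the zeros never outnumber the
-- ones, and they are strictly fewer when the edge crosses the cut. Summed over a Hamiltonian cycle
-- every vertex is counted twice and some edge crosses the cut, so the suffix from p has more ones
-- than zeros; at block boundaries this is the stated condition.
--
-- With the zeros z₀ < z₁ < ⋯ < z_k and the ones y₀ < y₁ < ⋯ < y_k of b (b starts with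
-- a zero), z₀ y₀ z₁ y₁ ⋯ z_k y_k z₀ is a Hamiltonian cycle as soon as every yᵢ lies after zᵢ₊₁,
-- i.e. the zeros keep a positive surplus over the ones on every nonempty proper prefix of b; given
-- the balance of the totals this is the block condition.

zeros ones : List Bool → ℕ
zeros []          = 0
zeros (false ∷ b) = suc (zeros b)
zeros (true ∷ b)  = zeros b
ones []          = 0
ones (false ∷ b) = ones b
ones (true ∷ b)  = suc (ones b)

length≡zeros+ones : ∀ b → length b ≡ zeros b + ones b
length≡zeros+ones []          = refl
length≡zeros+ones (false ∷ b) = cong suc (length≡zeros+ones b)
length≡zeros+ones (true ∷ b)  = trans (cong suc (length≡zeros+ones b)) (sym (+-suc (zeros b) (ones b)))

drop-length-++ : ∀ {A : Set} (xs ys : List A) → drop (length xs) (xs ++ ys) ≡ ys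
drop-length-++ []       ys = refl
drop-length-++ (x ∷ xs) ys = drop-length-++ xs ys

module _ {A : Set} where

  edgeSum : (A → ℕ) → List A → ℕ
  edgeSum f (x ∷ y ∷ ys) = f x + f y + edgeSum f (y ∷ ys)
  edgeSum f _            = 0

  edgeSum-++ : ∀ f x ys z → edgeSum f (x ∷ ys ++ [ z ]) ≡ f x + 2 * sum (map f ys) + f z
  edgeSum-++ f x []       z = solve (f x) (f z)
    where solve : ∀ a c → a + c + 0 ≡ a + 2 * 0 + c
          solve = solve-∀
  edgeSum-++ f x (y ∷ ys) z = trans (cong (f x + f y +_) (edgeSum-++ f y ys z)) (solve (f x) (f y) (sum (map f ys)) (f z))
    where solve : ∀ a b S c → a + b + (b + 2 * S + c) ≡ a + 2 * (b + S) + c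
          solve = solve-∀

  edgeSum-closed : ∀ f v xs → edgeSum f (v ∷ xs ++ [ v ]) ≡ 2 * sum (map f (v ∷ xs))
  edgeSum-closed f v xs = trans (edgeSum-++ f v xs v) (solve (f v) (sum (map f xs)))
    where solve : ∀ a S → a + 2 * S + a ≡ 2 * (a + S)
          solve = solve-∀

  module _ {R : A → A → Set} {f g : A → ℕ}
           (edge-≤ : ∀ {x y} → R x y → f x + f y ≤ g x + g y) where

    edgeSum-≤ : ∀ {w} → Linked R w → edgeSum f w ≤ edgeSum g w
    edgeSum-≤ []             = z≤n
    edgeSum-≤ [-]            = z≤n
    edgeSum-≤ (rxy ∷ linked) = +-mono-≤ (edge-≤ rxy) (edgeSum-≤ linked)

    -- A walk visiting both sides of the cut P must cross it along some edge.
    edgeSum-< : (P : A → Bool) → (∀ {x y} → R x y → P x ≢ P y → f x + f y < g x + g y)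
              → ∀ {w} → Linked R w → Any (λ x → P x ≡ false) w → Any (λ x → P x ≡ true) w
              → edgeSum f w < edgeSum g w
    edgeSum-< P edge-< [-] (here px) (here px′) with () ← trans (sym px) px′
    edgeSum-< P edge-< {x ∷ y ∷ ys} (rxy ∷ linked) out inn with P x Bool.≟ P y
    ... | no  crossing = +-mono-<-≤ (edge-< rxy crossing) (edgeSum-≤ linked)
    ... | yes same     = +-mono-≤-< (edge-≤ rxy) (edgeSum-< P edge-< linked (skip out) (skip inn))
      where
      skip : ∀ {c} → Any (λ z → P z ≡ c) (x ∷ y ∷ ys) → Any (λ z → P z ≡ c) (y ∷ ys)
      skip (here px) = here (trans (sym same) px)
      skip (there a) = a

unique∧complete⇒↭allFin : ∀ {n} {xs : List (Fin n)} → Unique xs → (∀ u → u ∈ xs) → xs ↭ allFin n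
unique∧complete⇒↭allFin {n} unique complete =
  ∼bag⇒↭ (unique∧set⇒bag unique (allFin⁺ n) (mk⇔ (λ _ → ∈-allFin _) (λ _ → complete _)))

↭allFin⇒hamiltonian : ∀ {n Adj} v rest → v ∷ rest ↭ allFin n → 3 ≤ n
                     → Linked Adj (v ∷ rest ++ [ v ]) → Hamiltonian n Adj
↭allFin⇒hamiltonian {n} v rest arrangement 3≤n linked =
  v , rest ,
  Permₛ.Unique-resp-↭ (setoid (Fin n)) (↭⇒↭ₛ (↭-sym arrangement)) (allFin⁺ n) ,
  (λ u → ∈-resp-↭ (↭-sym arrangement) (∈-allFin u)) ,
  subst (3 ≤_) (sym (trans (↭-length arrangement) (length-tabulate id))) 3≤n ,
  linked

indicator : Bool → ℕ
indicator true  = 1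
indicator false = 0

inSuffix : ℕ → ∀ {n} → Fin n → Bool
inSuffix p x = p ≤ᵇ toℕ x

inSuffix-upward : ∀ p {n} {x y : Fin n} → x <ᶠ y → T (inSuffix p x) → T (inSuffix p y)
inSuffix-upward p {x = x} {y} x<y px = ≤⇒≤ᵇ (≤-trans (≤ᵇ⇒≤ p (toℕ x) px) (<⇒≤ x<y))

zeroWeight oneWeight : ℕ → (b : List Bool) → Fin (length b) → ℕ
zeroWeight p b x = indicator (inSuffix p x ∧ not (lookup b x))
oneWeight  p b x = indicator (inSuffix p x ∧ lookup b x)

-- The last two clauses are split because suc p ≤ᵇ suc m only reduces to p ≤ᵇ m for p a constructor.
sum-zeroWeight : ∀ p b → sum (tabulate (zeroWeight p b)) ≡ zeros (drop p b)
sum-zeroWeight zero          []          = refl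
sum-zeroWeight (suc p)       []          = refl
sum-zeroWeight zero          (false ∷ b) = cong suc (sum-zeroWeight zero b)
sum-zeroWeight zero          (true ∷ b)  = sum-zeroWeight zero b
sum-zeroWeight (suc zero)    (_ ∷ b)     = sum-zeroWeight zero b
sum-zeroWeight (suc (suc p)) (_ ∷ b)     = sum-zeroWeight (suc p) b

sum-oneWeight : ∀ p b → sum (tabulate (oneWeight p b)) ≡ ones (drop p b)
sum-oneWeight zero          []          = refl
sum-oneWeight (suc p)       []          = refl
sum-oneWeight zero          (false ∷ b) = sum-oneWeight zero b
sum-oneWeight zero          (true ∷ b)  = cong suc (sum-oneWeight zero b)
sum-oneWeight (suc zero)    (_ ∷ b)     = sum-oneWeight zero b
sum-oneWeight (suc (suc p)) (_ ∷ b)     = sum-oneWeight (suc p) b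

-- u, v: whether the endpoints x < y lie in the suffix; c, d: their bits, d = 1 being what makes xy an edge.
edgeWeights-≤ : ∀ u v c d → d ≡ true → (T u → T v)
              → indicator (u ∧ not c) + indicator (v ∧ not d) ≤ indicator (u ∧ c) + indicator (v ∧ d)
edgeWeights-≤ true  true  true  _ refl _  = z≤n
edgeWeights-≤ true  true  false _ refl _  = ≤-refl
edgeWeights-≤ true  false _     _ refl uv = ⊥-elim (uv _)
edgeWeights-≤ false true  _     _ refl _  = z≤n
edgeWeights-≤ false false _     _ refl _  = z≤n

edgeWeights-< : ∀ u v c d → d ≡ true → (T u → T v) → u ≢ v
              → indicator (u ∧ not c) + indicator (v ∧ not d) < indicator (u ∧ c) + indicator (v ∧ d)
edgeWeights-< true  true  _ _ refl _  u≢v = ⊥-elim (u≢v refl)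
edgeWeights-< true  false _ _ refl uv _   = ⊥-elim (uv _)
edgeWeights-< false true  _ _ refl _  _   = s≤s z≤n
edgeWeights-< false false _ _ refl _  u≢v = ⊥-elim (u≢v refl)

module _ (p : ℕ) (b : List Bool) where

  private
    zw ow : Fin (length b) → ℕ
    zw = zeroWeight p b
    ow = oneWeight p b

    swap : ∀ {_∼_ : ℕ → ℕ → Set} {x y} → (zw y + zw x) ∼ (ow y + ow x) → (zw x + zw y) ∼ (ow x + ow y)
    swap {_∼_} {x} {y} = subst₂ _∼_ (+-comm (zw y) (zw x)) (+-comm (ow y) (ow x))

  thresholdEdge-≤ : ∀ {x y} → ThresholdAdj b x y → zw x + zw y ≤ ow x + ow y
  thresholdEdge-≤ {x} {y} (inj₁ (x<y , by)) =
    edgeWeights-≤ (inSuffix p x) (inSuffix p y) (lookup b x) (lookup b y) by (inSuffix-upward p x<y)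
  thresholdEdge-≤ {x} {y} (inj₂ (y<x , bx)) = swap {_≤_}
    (edgeWeights-≤ (inSuffix p y) (inSuffix p x) (lookup b y) (lookup b x) bx (inSuffix-upward p y<x))

  thresholdEdge-< : ∀ {x y} → ThresholdAdj b x y → inSuffix p x ≢ inSuffix p y → zw x + zw y < ow x + ow y
  thresholdEdge-< {x} {y} (inj₁ (x<y , by)) crossing =
    edgeWeights-< (inSuffix p x) (inSuffix p y) (lookup b x) (lookup b y) by (inSuffix-upward p x<y) crossing
  thresholdEdge-< {x} {y} (inj₂ (y<x , bx)) crossing = swap {_<_}
    (edgeWeights-< (inSuffix p y) (inSuffix p x) (lookup b y) (lookup b x) bx (inSuffix-upward p y<x) (crossing ∘ sym))

hamiltonian⇒ones-dominate-suffixes : ∀ b → Hamiltonian (length b) (ThresholdAdj b)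
                                    → ∀ p → 1 ≤ p → p < length b → zeros (drop p b) < ones (drop p b)
hamiltonian⇒ones-dominate-suffixes b@(_ ∷ _) (v , rest , unique , complete , _ , linked) p@(suc _) _ p<n =
  *-cancelˡ-< 2 _ _ (subst₂ _<_ (twiceTotal (zeroWeight p b) (sum-zeroWeight p b))
                                 (twiceTotal (oneWeight p b) (sum-oneWeight p b))
    (edgeSum-< (thresholdEdge-≤ p b) (inSuffix p) (thresholdEdge-< p b) linked outside inside))
  where
  walk : List (Fin (length b))
  walk = v ∷ rest ++ [ v ]

  twiceTotal : ∀ w {c} → sum (tabulate w) ≡ c → edgeSum w walk ≡ 2 * c
  twiceTotal w {c} total = begin
    edgeSum w walk                       ≡⟨ edgeSum-closed w v rest ⟩
    2 * sum (map w (v ∷ rest))           ≡⟨ cong (2 *_) (sum-↭ (map⁺ w (unique∧complete⇒↭allFin unique complete))) ⟩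
    2 * sum (map w (allFin (length b)))  ≡⟨ cong (λ xs → 2 * sum xs) (map-tabulate id w) ⟩
    2 * sum (tabulate w)                 ≡⟨ cong (2 *_) total ⟩
    2 * c                                ∎
    where open ≡-Reasoning

  outside : Any (λ x → inSuffix p x ≡ false) walk
  outside = lose (∈-++⁺ˡ (complete fzero)) refl

  inside : Any (λ x → inSuffix p x ≡ true) walk
  inside = lose (∈-++⁺ˡ (complete (fromℕ< p<n)))
                (Equivalence.to Bool.T-≡ (≤⇒≤ᵇ (≤-reflexive (sym (toℕ-fromℕ< p<n)))))

-- Reading b left to right with h unmatched zeros: each 1 matches a zero, and h stays positive until b ends.
data Surplus : ℕ → List Bool → Set where
  last : Surplus 1 [ true ]
  push : ∀ {h b} → Surplus (suc h) b → Surplus h (false ∷ b)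
  pop  : ∀ {h b} → Surplus (suc h) b → Surplus (suc (suc h)) (true ∷ b)

surplus-zeros : ∀ t {h b} → Surplus (t + h) b → Surplus h (replicate t false ++ b)
surplus-zeros zero            σ = σ
surplus-zeros (suc t) {h} {b} σ = push (surplus-zeros t (subst (λ k → Surplus k b) (sym (+-suc t h)) σ))

surplus-ones : ∀ s {h b} → Surplus (suc h) b → Surplus (suc (s + h)) (replicate s true ++ b)
surplus-ones zero    σ = σ
surplus-ones (suc s) σ = pop (surplus-ones s σ)

surplus-last : ∀ s → Surplus (suc s) (replicate (suc s) true)
surplus-last zero    = last
surplus-last (suc s) = pop (surplus-last s)

zeroPositions onePositions : ∀ {A : Set} (b : List Bool) → (Fin (length b) → A) → List A
zeroPositions []          f = []
zeroPositions (false ∷ b) f = f fzero ∷ zeroPositions b (f ∘ fsuc)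
zeroPositions (true ∷ b)  f = zeroPositions b (f ∘ fsuc)
onePositions []          f = []
onePositions (false ∷ b) f = onePositions b (f ∘ fsuc)
onePositions (true ∷ b)  f = f fzero ∷ onePositions b (f ∘ fsuc)

positions-↭ : ∀ {A : Set} b (f : Fin (length b) → A) → zeroPositions b f ++ onePositions b f ↭ tabulate f
positions-↭ []          f = ↭-refl
positions-↭ (false ∷ b) f = prep (f fzero) (positions-↭ b (f ∘ fsuc))
positions-↭ (true ∷ b)  f =
  ↭-trans (shift (f fzero) (zeroPositions b (f ∘ fsuc)) _) (prep (f fzero) (positions-↭ b (f ∘ fsuc)))

All-onePositions : ∀ {A : Set} {P : A → Set} b (f : Fin (length b) → A)
                 → (∀ k → lookup b k ≡ true → P (f k)) → All P (onePositions b f)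
All-onePositions []          f hyp = []
All-onePositions (false ∷ b) f hyp = All-onePositions b (f ∘ fsuc) (hyp ∘ fsuc)
All-onePositions (true ∷ b)  f hyp = hyp fzero refl ∷ All-onePositions b (f ∘ fsuc) (hyp ∘ fsuc)

interleave : ∀ {A : Set} → List A → List A → List A
interleave []       ys = ys
interleave (x ∷ xs) ys = x ∷ interleave ys xs

interleave-↭ : ∀ {A : Set} (xs ys : List A) → interleave xs ys ↭ xs ++ ys
interleave-↭ []       ys = ↭-refl
interleave-↭ (x ∷ xs) ys = prep x (↭-trans (interleave-↭ ys xs) (++-comm ys xs))

-- x₀ y₀ x₁ y₁ … x_k y_k with every yᵢ above both of its neighbours xᵢ and xᵢ₊₁.
data Zigzag {n} : List (Fin n) → List (Fin n) → Set where
  zigzag₁ : ∀ {x y} → x <ᶠ y → Zigzag [ x ] [ y ]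
  zigzag∷ : ∀ {x x′ xs y ys} → x <ᶠ y → x′ <ᶠ y → Zigzag (x′ ∷ xs) ys → Zigzag (x ∷ x′ ∷ xs) (y ∷ ys)

-- q ∷ Q is the queue of zeros still waiting for a 1; each 1 is placed after the two oldest.
surplus⇒zigzag : ∀ {n} b (f : Fin (length b) → Fin n) → f Preserves _<ᶠ_ ⟶ _<ᶠ_
               → ∀ q Q → All (λ x → ∀ k → x <ᶠ f k) (q ∷ Q) → Surplus (length (q ∷ Q)) b
               → Zigzag (q ∷ Q ++ zeroPositions b f) (onePositions b f)
surplus⇒zigzag (false ∷ b) f mono q Q below (push σ) =
  subst (λ xs → Zigzag (q ∷ xs) _) (++-assoc Q [ f fzero ] _)
    (surplus⇒zigzag b (f ∘ fsuc) (mono ∘ s≤s) q (Q ++ [ f fzero ]) below′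
      (subst (λ h → Surplus (suc h) b) (sym (trans (length-++ Q) (+-comm (length Q) 1))) σ))
  where
  below′ : All (λ x → ∀ k → x <ᶠ f (fsuc k)) (q ∷ Q ++ [ f fzero ])
  below′ = All-++⁺ (All.map (_∘ fsuc) below) ((λ _ → mono (s≤s z≤n)) ∷ [])
surplus⇒zigzag (true ∷ []) f mono q [] (q< ∷ []) last = zigzag₁ (q< fzero)
surplus⇒zigzag (true ∷ b) f mono q (q′ ∷ Q) (q< ∷ q′< ∷ below) (pop σ) =
  zigzag∷ (q< fzero) (q′< fzero)
    (surplus⇒zigzag b (f ∘ fsuc) (mono ∘ s≤s) q′ Q (All.map (_∘ fsuc) (q′< ∷ below)) σ)

zigzag⇒closedWalk : ∀ b {x₀ xs ys} → Zigzag xs ys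
                  → All (λ y → lookup b y ≡ true) ys → All (x₀ <ᶠ_) ys
                  → Linked (ThresholdAdj b) (interleave xs ys ++ [ x₀ ])
zigzag⇒closedWalk b (zigzag₁ x<y) (by ∷ []) (x₀<y ∷ []) = inj₁ (x<y , by) ∷ inj₂ (x₀<y , by) ∷ [-]
zigzag⇒closedWalk b (zigzag∷ x<y x′<y zz) (by ∷ bys) (_ ∷ x₀<ys) =
  inj₁ (x<y , by) ∷ inj₂ (x′<y , by) ∷ zigzag⇒closedWalk b zz bys x₀<ys

surplus⇒hamiltonian : ∀ b → Surplus 0 b → 3 ≤ length b → Hamiltonian (length b) (ThresholdAdj b)
surplus⇒hamiltonian (false ∷ b) (push σ) 3≤n =
  ↭allFin⇒hamiltonian fzero (interleave oneVertices zeroVertices) arrangement 3≤n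
    (zigzag⇒closedWalk (false ∷ b) zigzag (All-onePositions b fsuc (λ _ b≡1 → b≡1))
                                          (All-onePositions b fsuc (λ _ _ → s≤s z≤n)))
  where
  zeroVertices oneVertices : List (Fin (suc (length b)))
  zeroVertices = zeroPositions b fsuc
  oneVertices  = onePositions b fsuc

  arrangement : fzero ∷ interleave oneVertices zeroVertices ↭ allFin (suc (length b))
  arrangement = ↭-trans (interleave-↭ (fzero ∷ zeroVertices) oneVertices) (positions-↭ (false ∷ b) id)

  zigzag : Zigzag (fzero ∷ zeroVertices) oneVertices
  zigzag = surplus⇒zigzag b fsuc s≤s fzero [] ((λ _ → s≤s z≤n) ∷ []) σ

zeros-blockSeq : ∀ bs → zeros (blockSeq bs) ≡ sumT bs
zeros-blockSeq []                      = refl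
zeros-blockSeq ((suc t , s) ∷ bs)      = cong suc (zeros-blockSeq ((t , s) ∷ bs))
zeros-blockSeq ((zero , suc s) ∷ bs)   = zeros-blockSeq ((zero , s) ∷ bs)
zeros-blockSeq ((zero , zero) ∷ bs)    = zeros-blockSeq bs

ones-blockSeq : ∀ bs → ones (blockSeq bs) ≡ sumS bs
ones-blockSeq []                       = refl
ones-blockSeq ((suc t , s) ∷ bs)       = ones-blockSeq ((t , s) ∷ bs)
ones-blockSeq ((zero , suc s) ∷ bs)    = cong suc (ones-blockSeq ((zero , s) ∷ bs))
ones-blockSeq ((zero , zero) ∷ bs)     = ones-blockSeq bs

blockSeq-take++drop : ∀ j bs → blockSeq bs ≡ blockSeq (take j bs) ++ blockSeq (drop j bs)
blockSeq-take++drop j bs =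
  trans (cong blockSeq (sym (take++drop≡id j bs))) (concatMap-++ _ (take j bs) (drop j bs))

drop-blockSeq : ∀ j bs → drop (length (blockSeq (take j bs))) (blockSeq bs) ≡ blockSeq (drop j bs)
drop-blockSeq j bs =
  trans (cong (drop (length (blockSeq (take j bs)))) (blockSeq-take++drop j bs)) (drop-length-++ (blockSeq (take j bs)) _)

blockSeq-nonempty : ∀ {t s} bs → 1 ≤ t → 1 ≤ length (blockSeq ((t , s) ∷ bs))
blockSeq-nonempty {suc t} _ _ = s≤s z≤n

drop-blockSeq-nonempty : ∀ j bs → j < length bs → All ((1 ≤_) ∘ proj₁) bs → 1 ≤ length (blockSeq (drop j bs))
drop-blockSeq-nonempty zero    (_ ∷ bs) _         (1≤t ∷ _)   = blockSeq-nonempty bs 1≤t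
drop-blockSeq-nonempty (suc j) (_ ∷ bs) (s≤s j<n) (_ ∷ 1≤ts) = drop-blockSeq-nonempty j bs j<n 1≤ts

BlockSuffixCondition : List (ℕ × ℕ) → Set
BlockSuffixCondition bs = ∀ j → 1 ≤ j → j < length bs → suc (sumT (drop j bs)) ≤ sumS (drop j bs)

blockBoundary : ∀ j bs → 1 ≤ j → j < length bs → All ((1 ≤_) ∘ proj₁) bs
              → 1 ≤ length (blockSeq (take j bs)) × length (blockSeq (take j bs)) < length (blockSeq bs)
blockBoundary j@(suc j′) bs@((_ , _) ∷ bs′) _ j<n 1≤ts@(1≤t ∷ _) =
  blockSeq-nonempty (take j′ bs′) 1≤t ,
  subst (length (blockSeq (take j bs)) <_)
    (sym (trans (cong length (blockSeq-take++drop j bs)) (length-++ (blockSeq (take j bs)))))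
    (m<m+n _ (drop-blockSeq-nonempty j bs j<n 1≤ts))

hamiltonian⇒blockSuffixCondition : ∀ bs → All ((1 ≤_) ∘ proj₁) bs
                                  → Hamiltonian (length (blockSeq bs)) (ThresholdAdj (blockSeq bs))
                                  → BlockSuffixCondition bs
hamiltonian⇒blockSuffixCondition bs 1≤ts ham j 1≤j j<n
  with 1≤cut , cut<n ← blockBoundary j bs 1≤j j<n 1≤ts =
  subst₂ _<_ (trans (cong zeros (drop-blockSeq j bs)) (zeros-blockSeq (drop j bs)))
             (trans (cong ones (drop-blockSeq j bs)) (ones-blockSeq (drop j bs)))
    (hamiltonian⇒ones-dominate-suffixes (blockSeq bs) ham _ 1≤cut cut<n)

surplus-balance : ∀ h t s T k → h + (t + T) ≡ s + suc (T + k) → t + h ≡ suc (s + k)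
surplus-balance h t s T k eq = +-cancelʳ-≡ T _ _ (trans (shuffle h t T) (trans eq (shuffle′ s T k)))
  where
  shuffle : ∀ h t T → t + h + T ≡ h + (t + T)
  shuffle = solve-∀
  shuffle′ : ∀ s T k → s + suc (T + k) ≡ suc (s + k) + T
  shuffle′ = solve-∀

surplus-blockSeq : ∀ h bs → 1 ≤ length bs → All ((1 ≤_) ∘ proj₂) bs → h + sumT bs ≡ sumS bs
                 → BlockSuffixCondition bs → Surplus h (blockSeq bs)
surplus-blockSeq h ((t , zero) ∷ []) _ (() ∷ []) _ _
surplus-blockSeq h ((t , suc s) ∷ []) _ _ eq _ =
  subst (Surplus h) (sym (++-identityʳ (replicate t false ++ replicate (suc s) true)))
    (surplus-zeros t (subst (λ m → Surplus m (replicate (suc s) true)) (sym t+h≡1+s) (surplus-last s)))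
  where
  shuffle : ∀ t h → t + h ≡ h + (t + 0)
  shuffle = solve-∀
  t+h≡1+s : t + h ≡ suc s
  t+h≡1+s = trans (shuffle t h) (trans eq (+-identityʳ (suc s)))
surplus-blockSeq h ((t , s) ∷ bs@(_ ∷ _)) _ (_ ∷ 1≤ss) eq cond
  with k , T+k≡S ← m≤n⇒∃[o]m+o≡n (cond 1 (s≤s z≤n) (s≤s (s≤s z≤n))) =
  subst (Surplus h) (sym (++-assoc (replicate t false) (replicate s true) (blockSeq bs)))
    (surplus-zeros t (subst (λ m → Surplus m (replicate s true ++ blockSeq bs)) (sym t+h≡1+s+k)
      (surplus-ones s (surplus-blockSeq (suc k) bs (s≤s z≤n) 1≤ss eq′
        (λ j _ j<n → cond (suc j) (s≤s z≤n) (s≤s j<n))))))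
  where
  t+h≡1+s+k : t + h ≡ suc (s + k)
  t+h≡1+s+k = surplus-balance h t s (sumT bs) k (trans eq (cong (s +_) (sym T+k≡S)))
  eq′ : suc k + sumT bs ≡ sumS bs
  eq′ = trans (cong suc (+-comm k (sumT bs))) T+k≡S

blockSuffixCondition⇒hamiltonian : ∀ bs → 1 ≤ length bs → All ((1 ≤_) ∘ proj₂) bs
                                  → sumS bs ≡ sumT bs → 2 ≤ sumT bs → BlockSuffixCondition bs
                                  → Hamiltonian (length (blockSeq bs)) (ThresholdAdj (blockSeq bs))
blockSuffixCondition⇒hamiltonian bs 1≤h 1≤ss balanced 2≤T cond =
  surplus⇒hamiltonian (blockSeq bs) (surplus-blockSeq 0 bs 1≤h 1≤ss (sym balanced) cond) 3≤n
  where
  open ≤-Reasoning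
  3≤n : 3 ≤ length (blockSeq bs)
  3≤n = begin
    3                                              ≤⟨ n≤1+n 3 ⟩
    2 + 2                                          ≤⟨ +-mono-≤ 2≤T (≤-trans 2≤T (≤-reflexive (sym balanced))) ⟩
    sumT bs + sumS bs                              ≡⟨ cong₂ _+_ (zeros-blockSeq bs) (ones-blockSeq bs) ⟨
    zeros (blockSeq bs) + ones (blockSeq bs)       ≡⟨ length≡zeros+ones (blockSeq bs) ⟨
    length (blockSeq bs)                           ∎

lemma3p4 : (blocks : List (ℕ × ℕ)) → 1 ≤ length blocks
    → All (λ p → 1 ≤ proj₁ p × 1 ≤ proj₂ p) blocks
    → sumS blocks ≡ sumT blocks → 2 ≤ sumT blocks
    → Hamiltonian (length (blockSeq blocks)) (ThresholdAdj (blockSeq blocks))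
      ⇔ (∀ j → 1 ≤ j → j < length blocks → suc (sumT (drop j blocks)) ≤ sumS (drop j blocks))
lemma3p4 blocks 1≤h positive balanced 2≤T =
  mk⇔ (hamiltonian⇒blockSuffixCondition blocks (All.map proj₁ positive))
      (blockSuffixCondition⇒hamiltonian blocks 1≤h (All.map proj₂ positive) balanced 2≤T)
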